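{- Let $w$ be a computation with $[w]=1$ whose contexts are all irreducible, and let $\pi$ be a reduction of $w$. The relation $R_\pi$ never relates two blocks that lie in the same context of $w$.
   Context: Let $G=(V,I)$ be an undirected graph ($I$ symmetric, self-loops allowed); $\mathrm{Ops}=\{o^+,o^-\mid o\in V\}$; $\cong$ the smallest congruence on $\mathrm{Ops}^*$ with $o_1^{\pm}o_2^{\pm}\cong o_2^{\pm}o_1^{\pm}$ for $o_1\,I\,o_2$ and $o^+o^-\cong\varepsilon$; $[w]$ the class of $w$, $1=[\varepsilon]$. A set of symbols is dependent if it contains no two distinct independent symbols; a word is dependent if its set of symbols is. Context decomposition of $w\in\mathrm{Ops}^+$: if $w$ is dependent it is one context; else the first context is the maximal dependent prefix, followed by the context decomposition of the rest. A word is irreducible if it cannot be written as $w'\,a\,w_I\,b\,w''$ with either ($a=o^+$, $b=o^-$, and $o$ commutes with every symbol occurring in $w_I$) or ($a=o^-$, $b=o^+$, $o\,I\,o$, and $o$ commutes with every symbol occurring in $w_I$). A reduction of a word is a finite sequence of applications of the rules (R1) delete an adjacent factor $o^+o^-$; (R2) delete an adjacent factor $o^-o^+$ if $o\,I\,o$; (R3) swap adjacent letters $a\in\{o_1^\pm\}$, $b\in\{o_2^\pm\}$ if $o_1\,I\,o_2$, $o_1\ne o_2$; transforming it into $\varepsilon$. Letters of $w$ are annotated by their positions. For $\pi$: letters $x\,R_\pi\,y$ if $\pi$ deletes them together in one application of (R1) or (R2); inductively for infixes of contexts, $t_1s_1\,R_\pi\,s_2t_2$ if there are contexts $w_i=w_{i1}t_1s_1w_{i2}$,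 $w_j=w_{j1}s_2t_2w_{j2}$ with $s_1\,R_\pi\,s_2$ and $t_1\,R_\pi\,t_2$. A cluster is an infix $u$ of a context $w_i$ with $u\,R_\pi\,u'$ for some infix $u'$ of some context $w_j$; a block is a maximal cluster of $w_i$. -}

module Defs where

open import Data.Nat using (ℕ; zero; suc; _+_; _≤_; _<_)
open import Data.List using (List; []; _∷_; _++_; length; take; map; lookup)
open import Data.Nat.ListAction using (sum)
open import Data.List.Membership.Propositional using (_∈_)
open import Data.List.Relation.Unary.All using (All)
open import Data.Product using (Σ; ∃; ∃-syntax; _×_; _,_; proj₁; proj₂)
open import Data.Sum using (_⊎_)
open import Data.Fin using (Fin; toℕ)
open import Relation.Nullary using (¬_)
open import Relation.Binary.PropositionalEquality using (_≡_; _≢_)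

-- Signs of operations: o⁺ is (o , plus), o⁻ is (o , minus).
data Sign : Set where
  plus minus : Sign

Op : Set → Set
Op V = V × Sign

Word : Set → Set
Word V = List (Op V)

-- Letters annotated by their position in the original word.
AWord : Set → Set
AWord V = List (ℕ × Op V)

annotate : {V : Set} → ℕ → Word V → AWord V
annotate n []      = []
annotate n (x ∷ w) = (n , x) ∷ annotate (suc n) w

-- An infix given by global position of its first letter and its length.
Infix : Set
Infix = ℕ × ℕ

module _ {V : Set} (I : V → V → Set) where

  data _≅_ : Word V → Word V → Set where
    ≅-refl   : ∀ {u} → u ≅ u
    ≅-sym    : ∀ {u v} → u ≅ v → v ≅ u
    ≅-trans  : ∀ {u v x} → u ≅ v → v ≅ x → u ≅ x
    ≅-comm   : ∀ u v o₁ s₁ o₂ s₂ → I o₁ o₂ →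
               (u ++ (o₁ , s₁) ∷ (o₂ , s₂) ∷ v) ≅ (u ++ (o₂ , s₂) ∷ (o₁ , s₁) ∷ v)
    ≅-cancel : ∀ u v o → (u ++ (o , plus) ∷ (o , minus) ∷ v) ≅ (u ++ v)

  IsOne : Word V → Set
  IsOne w = w ≅ []

  Dependent : Word V → Set
  Dependent w = ∀ {x y} → x ∈ w → y ∈ w → proj₁ x ≢ proj₁ y → ¬ I (proj₁ x) (proj₁ y)

  data ContextDecomposition : Word V → List (Word V) → Set where
    cd-one  : ∀ {w} → w ≢ [] → Dependent w → ContextDecomposition w (w ∷ [])
    cd-more : ∀ {p r cs} → ¬ Dependent (p ++ r) →
              -- p is the maximal dependent prefix of p ++ r
              Dependent p →
              (∀ q s → p ++ r ≡ q ++ s → length p < length q → ¬ Dependent q) →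
              ContextDecomposition r cs →
              ContextDecomposition (p ++ r) (p ∷ cs)

  data Reducible : Word V → Set where
    red⁺ : ∀ w' wI w'' o → All (λ x → I o (proj₁ x)) wI →
           Reducible (w' ++ (o , plus) ∷ wI ++ (o , minus) ∷ w'')
    red⁻ : ∀ w' wI w'' o → I o o → All (λ x → I o (proj₁ x)) wI →
           Reducible (w' ++ (o , minus) ∷ wI ++ (o , plus) ∷ w'')

  Irreducible : Word V → Set
  Irreducible w = ¬ Reducible w

  data Reduction : AWord V → Set where
    done : Reduction []
    R1   : ∀ xs ys i j o → Reduction (xs ++ ys) →
           Reduction (xs ++ (i , (o , plus)) ∷ (j , (o , minus)) ∷ ys)
    R2   : ∀ xs ys i j o → I o o → Reduction (xs ++ ys) →
           Reduction (xs ++ (i , (o , minus)) ∷ (j , (o , plus)) ∷ ys)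
    R3   : ∀ xs ys i j o₁ s₁ o₂ s₂ → I o₁ o₂ → o₁ ≢ o₂ →
           Reduction (xs ++ (j , (o₂ , s₂)) ∷ (i , (o₁ , s₁)) ∷ ys) →
           Reduction (xs ++ (i , (o₁ , s₁)) ∷ (j , (o₂ , s₂)) ∷ ys)

  deleted : ∀ {aw} → Reduction aw → List (ℕ × ℕ)
  deleted done                        = []
  deleted (R1 _ _ i j _ π)            = (i , j) ∷ deleted π
  deleted (R2 _ _ i j _ _ π)          = (i , j) ∷ deleted π
  deleted (R3 _ _ _ _ _ _ _ _ _ _ π)  = deleted π

  module _ {aw : AWord V} (π : Reduction aw) (cs : List (Word V)) where

    LetterRel : ℕ → ℕ → Set
    LetterRel x y = ((x , y) ∈ deleted π) ⊎ ((y , x) ∈ deleted π)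

    ctxStart : Fin (length cs) → ℕ
    ctxStart i = sum (map length (take (toℕ i) cs))

    InContext : Fin (length cs) → Infix → Set
    InContext i (a , k) = ctxStart i ≤ a × a + k ≤ ctxStart i + length (lookup cs i)

    InSomeContext : Infix → Set
    InSomeContext u = ∃[ i ] InContext i u

    -- R_π on infixes of contexts:
    -- t₁s₁ R_π s₂t₂ if s₁ R_π s₂ and t₁ R_π t₂ (t₁s₁, s₂t₂ infixes of contexts)
    data RInf : Infix → Infix → Set where
      base : ∀ {x y} → LetterRel x y → RInf (x , 1) (y , 1)
      join : ∀ {a k₁ k₂ b l₂ l₁} →
             RInf (a + k₁ , k₂) (b , l₂) →       -- s₁ R s₂
             RInf (a , k₁) (b + l₂ , l₁) →       -- t₁ R t₂
             InSomeContext (a , k₁ + k₂) →        -- t₁s₁ infix of a context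
             InSomeContext (b , l₂ + l₁) →        -- s₂t₂ infix of a context
             RInf (a , k₁ + k₂) (b , l₂ + l₁)

    Cluster : Fin (length cs) → Infix → Set
    Cluster i u = InContext i u × ∃[ u' ] RInf u u'

    Contains : Infix → Infix → Set
    Contains (b , l) (a , k) = b ≤ a × a + k ≤ b + l

    Block : Fin (length cs) → Infix → Set
    Block i u = Cluster i u × (∀ v → Cluster i v → Contains v u → v ≡ u)

module Submission where

-- The heart of the proof is an
-- invariant of reductions (`nested`): whenever π deletes the letters at
-- positions p and q together, then in the word π starts from p precedes q,
-- the two letters cancel (o⁺o⁻, or o⁻o⁺ with o I o), and every letter
-- strictly between them whose operation is dependent on o is itself deleted
-- together with a letter strictly between them.  It is checked step by step
-- along π: a deletion adds a pair with nothing in between, and an (R3)-swap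
-- of two independent letters never changes the order of two dependent ones.
--
-- In a context c any two operations are dependent.  If π deleted two letters
-- p < q of c together, induct on q - p: if q = p + 1 the factor cancels inside
-- c, contradicting irreducibility; otherwise the letter at p + 1 is deleted
-- with a partner strictly between p and q, a closer pair inside c.  Since
-- every instance of R_π on infixes relates a letter of the first infix to a
-- letter of the second, R_π relates no two infixes of one context, so in
-- particular no two blocks of one context.

open import Defs
open import Data.List using (List; []; _∷_; _++_; length; lookup; take; drop; map; concat)
open import Data.List.Properties using (length-++; ++-identityʳ; ++-assoc)
open import Data.List.Relation.Unary.All using (All; []; _∷_)
import Data.List.Relation.Unary.All as All
open import Data.List.Relation.Unary.Any using (Any; here; there)
import Data.List.Relation.Unary.Any as Any
open import Data.List.Relation.Unary.Any.Properties using (++⁺ˡ; ++⁺ʳ; ++⁻)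
open import Data.List.Membership.Propositional using (_∈_)
open import Data.List.Membership.Propositional.Properties using (∈-lookup)
open import Data.Nat using (ℕ; zero; suc; _+_; _≤_; _<_; z<s)
open import Data.Nat.Properties
open import Data.Nat.ListAction using (sum)
open import Data.Fin using (Fin; toℕ)
import Data.Fin as Fin
open import Data.Product using (Σ; _×_; _,_; proj₁; proj₂; swap; map₁; map₂)
open import Data.Sum using (_⊎_; inj₁; inj₂; [_,_]′)
import Data.Sum as Sum
open import Data.Empty using (⊥; ⊥-elim)
open import Data.Unit using (⊤; tt)
open import Function using (_∘_)
open import Relation.Nullary using (¬_)
open import Relation.Binary.PropositionalEquality

module AroundAdjacent {A : Set} {P : A → Set} where

  any-insert₂ : ∀ xs {ys a b} → Any P (xs ++ ys) → Any P (xs ++ a ∷ b ∷ ys)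
  any-insert₂ xs h = [ ++⁺ˡ , ++⁺ʳ xs ∘ there ∘ there ]′ (++⁻ xs h)

  any-remove₂ : ∀ xs {ys a b} → Any P (xs ++ a ∷ b ∷ ys) → Any P (xs ++ ys) ⊎ P a ⊎ P b
  any-remove₂ xs h with ++⁻ xs h
  ... | inj₁ h′                 = inj₁ (++⁺ˡ h′)
  ... | inj₂ (here pa)          = inj₂ (inj₁ pa)
  ... | inj₂ (there (here pb))  = inj₂ (inj₂ pb)
  ... | inj₂ (there (there h′)) = inj₁ (++⁺ʳ xs h′)

  any-swap : ∀ xs {ys a b} → Any P (xs ++ a ∷ b ∷ ys) → Any P (xs ++ b ∷ a ∷ ys)
  any-swap xs h with ++⁻ xs h
  ... | inj₁ h′                 = ++⁺ˡ h′
  ... | inj₂ (here pa)          = ++⁺ʳ xs (there (here pa))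
  ... | inj₂ (there (here pb))  = ++⁺ʳ xs (here pb)
  ... | inj₂ (there (there h′)) = ++⁺ʳ xs (there (there h′))

open AroundAdjacent

module Positions {V : Set} where

  _∈ₚ_ : ℕ → AWord V → Set
  r ∈ₚ L = Any (λ e → r ≡ proj₁ e) L

  data Before : AWord V → ℕ → ℕ → Set where
    ≺-head : ∀ {p l L q} → q ∈ₚ L → Before ((p , l) ∷ L) p q
    ≺-tail : ∀ {e L p q} → Before L p q → Before (e ∷ L) p q

  Distinct : AWord V → Set
  Distinct []      = ⊤
  Distinct (e ∷ L) = ¬ (proj₁ e ∈ₚ L) × Distinct L

  ∈⇒∈ₚ : ∀ {L r l} → (r , l) ∈ L → r ∈ₚ L
  ∈⇒∈ₚ = Any.map (cong proj₁)

  before-left : ∀ {L p q} → Before L p q → p ∈ₚ L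
  before-left (≺-head _) = here refl
  before-left (≺-tail b) = there (before-left b)

  before-right : ∀ {L p q} → Before L p q → q ∈ₚ L
  before-right (≺-head h) = there h
  before-right (≺-tail b) = there (before-right b)

  before-++ : ∀ xs {zs u v} → u ∈ₚ xs → v ∈ₚ zs → Before (xs ++ zs) u v
  before-++ (x ∷ xs) (here refl) hv = ≺-head (++⁺ʳ xs hv)
  before-++ (x ∷ xs) (there hu)  hv = ≺-tail (before-++ xs hu hv)

  fst-before : ∀ xs {ys p l v} → v ∈ₚ ys → Before (xs ++ (p , l) ∷ ys) p v
  fst-before []       h = ≺-head h
  fst-before (x ∷ xs) h = ≺-tail (fst-before xs h)

  snd-before : ∀ xs {ys a p l v} → v ∈ₚ ys → Before (xs ++ a ∷ (p , l) ∷ ys) p v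
  snd-before []       h = ≺-tail (≺-head h)
  snd-before (x ∷ xs) h = ≺-tail (snd-before xs h)

  distinct-suffix : ∀ xs {zs} → Distinct (xs ++ zs) → Distinct zs
  distinct-suffix []       d       = d
  distinct-suffix (x ∷ xs) (_ , d) = distinct-suffix xs d

  distinct-disjoint : ∀ xs {zs r} → Distinct (xs ++ zs) → r ∈ₚ xs → r ∈ₚ zs → ⊥
  distinct-disjoint (x ∷ xs) (n , d) (here refl) h₂ = n (++⁺ʳ xs h₂)
  distinct-disjoint (x ∷ xs) (n , d) (there h₁)  h₂ = distinct-disjoint xs d h₁ h₂

  distinct-functional : ∀ {L p l l′} → Distinct L → (p , l) ∈ L → (p , l′) ∈ L → l ≡ l′
  distinct-functional _       (here refl) (here refl) = refl
  distinct-functional (n , _) (here refl) (there m)   = ⊥-elim (n (∈⇒∈ₚ m))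
  distinct-functional (n , _) (there m)   (here refl) = ⊥-elim (n (∈⇒∈ₚ m))
  distinct-functional (_ , d) (there m)   (there m′)  = distinct-functional d m m′

  distinct-remove₂ : ∀ xs {ys a b} → Distinct (xs ++ a ∷ b ∷ ys) → Distinct (xs ++ ys)
  distinct-remove₂ []       (_ , (_ , d)) = d
  distinct-remove₂ (x ∷ xs) (n , d)       = n ∘ any-insert₂ xs , distinct-remove₂ xs d

  distinct-swap : ∀ xs {ys a b} → Distinct (xs ++ a ∷ b ∷ ys) → Distinct (xs ++ b ∷ a ∷ ys)
  distinct-swap [] (na , (nb , d)) =
    (λ { (here e) → na (here (sym e)) ; (there h) → nb h }) , (na ∘ there) , d
  distinct-swap (x ∷ xs) (n , d) = n ∘ any-swap xs , distinct-swap xs d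

  distinct-fst : ∀ xs {ys pa la b} → Distinct (xs ++ (pa , la) ∷ b ∷ ys) → ¬ pa ∈ₚ (xs ++ ys)
  distinct-fst []       (na , _) h         = na (there h)
  distinct-fst (x ∷ xs) (n , _) (here e)   = n (++⁺ʳ xs (here (sym e)))
  distinct-fst (x ∷ xs) (_ , d) (there h)  = distinct-fst xs d h

  distinct-snd : ∀ xs {ys a pb lb} → Distinct (xs ++ a ∷ (pb , lb) ∷ ys) → ¬ pb ∈ₚ (xs ++ ys)
  distinct-snd []       (_ , (nb , _)) h = nb h
  distinct-snd (x ∷ xs) (n , _) (here e)  = n (++⁺ʳ xs (there (here (sym e))))
  distinct-snd (x ∷ xs) (_ , d) (there h) = distinct-snd xs d h

  before-swap : ∀ xs {ys pa la pb lb u v} → Before (xs ++ (pa , la) ∷ (pb , lb) ∷ ys) u v →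
                (u ≡ pa × v ≡ pb) ⊎ Before (xs ++ (pb , lb) ∷ (pa , la) ∷ ys) u v
  before-swap []       (≺-head (here e))  = inj₁ (refl , e)
  before-swap []       (≺-head (there h)) = inj₂ (≺-tail (≺-head h))
  before-swap []       (≺-tail (≺-head h)) = inj₂ (≺-head (there h))
  before-swap []       (≺-tail (≺-tail b)) = inj₂ (≺-tail (≺-tail b))
  before-swap (x ∷ xs) (≺-head h)         = inj₂ (≺-head (any-swap xs h))
  before-swap (x ∷ xs) (≺-tail b)         = Sum.map₂ ≺-tail (before-swap xs b)

  before-insert₂ : ∀ xs {ys a b u v} → Before (xs ++ ys) u v → Before (xs ++ a ∷ b ∷ ys) u v
  before-insert₂ []       b          = ≺-tail (≺-tail b)
  before-insert₂ (x ∷ xs) (≺-head h) = ≺-head (any-insert₂ xs h)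
  before-insert₂ (x ∷ xs) (≺-tail b) = ≺-tail (before-insert₂ xs b)

  before-remove₂ : ∀ xs {ys pa la pb lb u v} → Distinct (xs ++ (pa , la) ∷ (pb , lb) ∷ ys) →
                   u ∈ₚ (xs ++ ys) → v ∈ₚ (xs ++ ys) →
                   Before (xs ++ (pa , la) ∷ (pb , lb) ∷ ys) u v → Before (xs ++ ys) u v
  before-remove₂ [] (na , _) hu _ (≺-head _) = ⊥-elim (na (there hu))
  before-remove₂ [] (_ , (nb , _)) hu _ (≺-tail (≺-head _)) = ⊥-elim (nb hu)
  before-remove₂ [] _ _ _ (≺-tail (≺-tail b)) = b
  before-remove₂ (x ∷ xs) (n , _) _ (here refl) (≺-head h) = ⊥-elim (n h)
  before-remove₂ (x ∷ xs) _ _ (there hv) (≺-head _) = ≺-head hv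
  before-remove₂ (x ∷ xs) (n , _) (here refl) _ (≺-tail b) = ⊥-elim (n (before-left b))
  before-remove₂ (x ∷ xs) (n , _) (there _) (here refl) (≺-tail b) = ⊥-elim (n (before-right b))
  before-remove₂ (x ∷ xs) (_ , d) (there hu) (there hv) (≺-tail b) = ≺-tail (before-remove₂ xs d hu hv b)

  before-fst : ∀ xs {ys pa la b u} → Distinct (xs ++ (pa , la) ∷ b ∷ ys) →
               Before (xs ++ (pa , la) ∷ b ∷ ys) u pa → u ∈ₚ xs
  before-fst []       (na , _) (≺-head h) = ⊥-elim (na h)
  before-fst []       (na , _) (≺-tail b) = ⊥-elim (na (before-right b))
  before-fst (x ∷ xs) _       (≺-head _) = here refl
  before-fst (x ∷ xs) (_ , d) (≺-tail b) = there (before-fst xs d b)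

  after-fst : ∀ xs {ys pa la pb lb v} → Distinct (xs ++ (pa , la) ∷ (pb , lb) ∷ ys) →
              Before (xs ++ (pa , la) ∷ (pb , lb) ∷ ys) pa v → v ∈ₚ ((pb , lb) ∷ ys)
  after-fst []       _        (≺-head h) = h
  after-fst []       (na , _) (≺-tail b) = ⊥-elim (na (before-left b))
  after-fst (x ∷ xs) (n , _)  (≺-head _) = ⊥-elim (n (++⁺ʳ xs (here refl)))
  after-fst (x ∷ xs) (_ , d)  (≺-tail b) = after-fst xs d b

  before-snd : ∀ xs {ys pa la pb lb u} → Distinct (xs ++ (pa , la) ∷ (pb , lb) ∷ ys) →
               Before (xs ++ (pa , la) ∷ (pb , lb) ∷ ys) u pb → u ∈ₚ xs ⊎ u ≡ pa
  before-snd []       _              (≺-head _)          = inj₂ refl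
  before-snd []       (_ , (nb , _)) (≺-tail (≺-head h)) = ⊥-elim (nb h)
  before-snd []       (_ , (nb , _)) (≺-tail (≺-tail b)) = ⊥-elim (nb (before-right b))
  before-snd (x ∷ xs) _              (≺-head _)          = inj₁ (here refl)
  before-snd (x ∷ xs) (_ , d)        (≺-tail b)          = Sum.map₁ there (before-snd xs d b)

  after-snd : ∀ xs {ys pa la pb lb v} → Distinct (xs ++ (pa , la) ∷ (pb , lb) ∷ ys) →
              Before (xs ++ (pa , la) ∷ (pb , lb) ∷ ys) pb v → v ∈ₚ ys
  after-snd []       (na , _)       (≺-head _)          = ⊥-elim (na (here refl))
  after-snd []       _              (≺-tail (≺-head h)) = h
  after-snd []       (_ , (nb , _)) (≺-tail (≺-tail b)) = ⊥-elim (nb (before-left b))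
  after-snd (x ∷ xs) (n , _)        (≺-head _)          = ⊥-elim (n (++⁺ʳ xs (there (here refl))))
  after-snd (x ∷ xs) (_ , d)        (≺-tail b)          = after-snd xs d b

  nothing-between : ∀ xs {ys pa la pb lb r} → Distinct (xs ++ (pa , la) ∷ (pb , lb) ∷ ys) →
                    Before (xs ++ (pa , la) ∷ (pb , lb) ∷ ys) pa r →
                    Before (xs ++ (pa , la) ∷ (pb , lb) ∷ ys) r pb → ⊥
  nothing-between xs d pa≺r r≺pb with after-fst xs d pa≺r | before-snd xs d r≺pb
  ... | r∈ | inj₁ r∈xs = distinct-disjoint xs d r∈xs (there r∈)
  ... | r∈ | inj₂ refl = proj₁ (distinct-suffix xs d) r∈

module Invariant {V : Set} (I : V → V → Set) where
  open Positions {V}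

  DepOp : V → V → Set
  DepOp o o′ = o ≢ o′ → ¬ I o o′ × ¬ I o′ o

  DepOp-refl : ∀ {o} → DepOp o o
  DepOp-refl o≢o = ⊥-elim (o≢o refl)

  DepOp-sym : ∀ {o o′} → DepOp o o′ → DepOp o′ o
  DepOp-sym d o′≢o = swap (d (o′≢o ∘ sym))

  swap-not-dependent : ∀ {o₁ o₂} → I o₁ o₂ → o₁ ≢ o₂ → ¬ DepOp o₁ o₂
  swap-not-dependent i o₁≢o₂ d = proj₁ (d o₁≢o₂) i

  data Cancelling : Op V → Op V → Set where
    plus-minus : ∀ {o} → Cancelling (o , plus) (o , minus)
    minus-plus : ∀ {o} → I o o → Cancelling (o , minus) (o , plus)

  cancelling-op : ∀ {l l′} → Cancelling l l′ → proj₁ l ≡ proj₁ l′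
  cancelling-op plus-minus     = refl
  cancelling-op (minus-plus _) = refl

  cancelling-reducible : ∀ A C {l l′} → Cancelling l l′ → Reducible I (A ++ l ∷ l′ ∷ C)
  cancelling-reducible A C (plus-minus {o})     = red⁺ A [] C o []
  cancelling-reducible A C (minus-plus {o} ioo) = red⁻ A [] C o ioo []

  Paired : List (ℕ × ℕ) → ℕ → ℕ → Set
  Paired D r r′ = (r , r′) ∈ D ⊎ (r′ , r) ∈ D

  record PartnerBetween (L : AWord V) (D : List (ℕ × ℕ)) (p q : ℕ) (o : V) (r : ℕ) : Set where
    constructor partner
    field
      r′     : ℕ
      l′     : Op V
      r′∈L   : (r′ , l′) ∈ L
      p≺r′   : Before L p r′
      r′≺q   : Before L r′ q
      dep′   : DepOp o (proj₁ l′)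
      paired : Paired D r r′

  Enclosed : AWord V → List (ℕ × ℕ) → ℕ → ℕ → V → Set
  Enclosed L D p q o = ∀ {r l} → (r , l) ∈ L → Before L p r → Before L r q →
                       DepOp o (proj₁ l) → PartnerBetween L D p q o r

  record Nested (L : AWord V) (D : List (ℕ × ℕ)) (p q : ℕ) : Set where
    constructor nest
    field
      {lp lq}  : Op V
      p∈L      : (p , lp) ∈ L
      q∈L      : (q , lq) ∈ L
      cancel   : Cancelling lp lq
      p≺q      : Before L p q
      enclosed : Enclosed L D p q (proj₁ lp)

  -- (R1)/(R2): the pair being deleted is nested, with nothing in between
  nested-new : ∀ xs {ys pa la pb lb} D → Cancelling la lb →
               Distinct (xs ++ (pa , la) ∷ (pb , lb) ∷ ys) →
               Nested (xs ++ (pa , la) ∷ (pb , lb) ∷ ys) ((pa , pb) ∷ D) pa pb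
  nested-new xs D c d =
    nest (++⁺ʳ xs (here refl)) (++⁺ʳ xs (there (here refl))) c (fst-before xs (here refl))
         (λ _ pa≺r r≺pb _ → ⊥-elim (nothing-between xs d pa≺r r≺pb))

  -- (R1)/(R2): a pair deleted later stays nested once the adjacent pair is put back;
  -- a deleted letter between p and q has its (adjacent) partner between them too
  nested-delete : ∀ xs {ys pa la pb lb D p q} → Cancelling la lb →
                  Distinct (xs ++ (pa , la) ∷ (pb , lb) ∷ ys) →
                  Nested (xs ++ ys) D p q →
                  Nested (xs ++ (pa , la) ∷ (pb , lb) ∷ ys) ((pa , pb) ∷ D) p q
  nested-delete xs {ys} {pa} {la} {pb} {lb} {D} {p} {q} c d (nest {lp} p∈ q∈ c′ p≺q enc) =
    nest (any-insert₂ xs p∈) (any-insert₂ xs q∈) c′ (before-insert₂ xs p≺q) enc′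
    where
    L = xs ++ (pa , la) ∷ (pb , lb) ∷ ys
    p∉ = distinct-fst xs d

    enc′ : Enclosed L ((pa , pb) ∷ D) p q (proj₁ lp)
    enc′ r∈ p≺r r≺q dep with any-remove₂ xs r∈
    ... | inj₁ r∈′ with enc r∈′ (before-remove₂ xs d (∈⇒∈ₚ p∈) (∈⇒∈ₚ r∈′) p≺r)
                                (before-remove₂ xs d (∈⇒∈ₚ r∈′) (∈⇒∈ₚ q∈) r≺q) dep
    ...   | partner r′ l′ r′∈ p≺r′ r′≺q dep′ pr =
      partner r′ l′ (any-insert₂ xs r′∈) (before-insert₂ xs p≺r′) (before-insert₂ xs r′≺q)
              dep′ (Sum.map there there pr)
    enc′ r∈ p≺r r≺q dep | inj₂ (inj₁ refl) =
      partner pb lb (++⁺ʳ xs (there (here refl)))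
              (before-++ xs (before-fst xs d p≺r) (there (here refl))) pb≺q
              (subst (DepOp (proj₁ lp)) (cancelling-op c) dep) (inj₁ (here refl))
      where
      pb≺q : Before L pb q
      pb≺q with after-fst xs d r≺q
      ... | here refl = ⊥-elim (distinct-snd xs d (∈⇒∈ₚ q∈))
      ... | there q∈ys = snd-before xs q∈ys
    enc′ r∈ p≺r r≺q dep | inj₂ (inj₂ refl) =
      partner pa la (++⁺ʳ xs (here refl)) p≺pa (fst-before xs (there (after-snd xs d r≺q)))
              (subst (DepOp (proj₁ lp)) (sym (cancelling-op c)) dep) (inj₂ (here refl))
      where
      p≺pa : Before L p pa
      p≺pa with before-snd xs d p≺r
      ... | inj₁ p∈xs = before-++ xs p∈xs (here refl)
      ... | inj₂ refl = ⊥-elim (distinct-fst xs d (∈⇒∈ₚ p∈))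

  reorder : ∀ xs {ys pa la pb lb u lu v lv} → ¬ DepOp (proj₁ la) (proj₁ lb) →
            Distinct (xs ++ (pa , la) ∷ (pb , lb) ∷ ys) →
            (u , lu) ∈ (xs ++ (pa , la) ∷ (pb , lb) ∷ ys) →
            (v , lv) ∈ (xs ++ (pa , la) ∷ (pb , lb) ∷ ys) → DepOp (proj₁ lu) (proj₁ lv) →
            Before (xs ++ (pa , la) ∷ (pb , lb) ∷ ys) u v →
            Before (xs ++ (pb , lb) ∷ (pa , la) ∷ ys) u v
  reorder xs indep d u∈ v∈ dep u≺v with before-swap xs u≺v
  ... | inj₂ u≺′v = u≺′v
  ... | inj₁ (refl , refl) =
    ⊥-elim (indep (subst₂ DepOp (cong proj₁ (distinct-functional d u∈ (++⁺ʳ xs (here refl))))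
                                (cong proj₁ (distinct-functional d v∈ (++⁺ʳ xs (there (here refl)))))
                                dep))

  nested-swap : ∀ xs {ys pa la pb lb D p q} →
                ¬ DepOp (proj₁ la) (proj₁ lb) → ¬ DepOp (proj₁ lb) (proj₁ la) →
                Distinct (xs ++ (pa , la) ∷ (pb , lb) ∷ ys) →
                Nested (xs ++ (pb , lb) ∷ (pa , la) ∷ ys) D p q →
                Nested (xs ++ (pa , la) ∷ (pb , lb) ∷ ys) D p q
  nested-swap xs {ys} {pa} {la} {pb} {lb} {D} {p} {q} indep indep′ d
              (nest {lp} {lq} p∈ q∈ c p≺q enc) =
    nest (any-swap xs p∈) (any-swap xs q∈) c (back p∈ q∈ (same-op DepOp-refl) p≺q) enc′
    where
    L  = xs ++ (pa , la) ∷ (pb , lb) ∷ ys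
    d′ = distinct-swap xs d

    same-op : ∀ {o} → DepOp (proj₁ lp) o → DepOp o (proj₁ lq)
    same-op dep = DepOp-sym (subst (λ o′ → DepOp o′ _) (cancelling-op c) dep)

    back : ∀ {u lu v lv} → (u , lu) ∈ (xs ++ (pb , lb) ∷ (pa , la) ∷ ys) →
           (v , lv) ∈ (xs ++ (pb , lb) ∷ (pa , la) ∷ ys) → DepOp (proj₁ lu) (proj₁ lv) →
           Before (xs ++ (pb , lb) ∷ (pa , la) ∷ ys) u v → Before L u v
    back = reorder xs indep′ d′

    enc′ : Enclosed L D p q (proj₁ lp)
    enc′ r∈ p≺r r≺q dep
      with enc (any-swap xs r∈) (reorder xs indep d (any-swap xs p∈) r∈ dep p≺r)
                               (reorder xs indep d r∈ (any-swap xs q∈) (same-op dep) r≺q) dep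
    ... | partner r′ l′ r′∈ p≺r′ r′≺q dep′ pr =
      partner r′ l′ (any-swap xs r′∈) (back p∈ r′∈ dep′ p≺r′) (back r′∈ q∈ (same-op dep′) r′≺q)
              dep′ pr

  nested : ∀ {L} (π : Reduction I L) → Distinct L →
           ∀ {p q} → (p , q) ∈ deleted I π → Nested L (deleted I π) p q
  nested (R1 xs ys i j o π′) d (here refl) = nested-new xs (deleted I π′) plus-minus d
  nested (R1 xs ys i j o π′) d (there pq) =
    nested-delete xs plus-minus d (nested π′ (distinct-remove₂ xs d) pq)
  nested (R2 xs ys i j o ioo π′) d (here refl) = nested-new xs (deleted I π′) (minus-plus ioo) d
  nested (R2 xs ys i j o ioo π′) d (there pq) =
    nested-delete xs (minus-plus ioo) d (nested π′ (distinct-remove₂ xs d) pq)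
  nested (R3 xs ys i j o₁ s₁ o₂ s₂ ind o₁≢o₂ π′) d pq =
    nested-swap xs (swap-not-dependent ind o₁≢o₂) (swap-not-dependent ind o₁≢o₂ ∘ DepOp-sym) d
                (nested π′ (distinct-swap xs d) pq)

module Annotated {V : Set} where
  open Positions {V}

  annotate-++ : ∀ n (xs ys : Word V) →
                annotate n (xs ++ ys) ≡ annotate n xs ++ annotate (n + length xs) ys
  annotate-++ n [] ys = cong (λ m → annotate m ys) (sym (+-identityʳ n))
  annotate-++ n (x ∷ xs) ys =
    cong ((n , x) ∷_) (trans (annotate-++ (suc n) xs ys)
                             (cong (λ m → annotate (suc n) xs ++ annotate m ys) (sym (+-suc n (length xs)))))

  annotate-range : ∀ {n} (w : Word V) {r} → r ∈ₚ annotate n w → n ≤ r × r < n + length w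
  annotate-range {n} (x ∷ w) (here refl) = ≤-refl , m<m+n n z<s
  annotate-range {n} (x ∷ w) {r} (there h) with annotate-range w h
  ... | n<r , r<end = <⇒≤ n<r , subst (r <_) (sym (+-suc n (length w))) r<end

  annotate-letter : ∀ {n} (w : Word V) {r l} → (r , l) ∈ annotate n w → l ∈ w
  annotate-letter (x ∷ w) (here refl) = here refl
  annotate-letter (x ∷ w) (there m)   = there (annotate-letter w m)

  annotate-complete : ∀ n (w : Word V) {r} → n ≤ r → r < n + length w →
                      Σ (Op V) λ l → (r , l) ∈ annotate n w
  annotate-complete n [] n≤r r<n+0 = ⊥-elim (<⇒≱ r<n+0 (subst (_≤ _) (sym (+-identityʳ n)) n≤r))
  annotate-complete n (x ∷ w) {r} n≤r r<end with m≤n⇒m<n∨m≡n n≤r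
  ... | inj₂ refl = x , here refl
  ... | inj₁ n<r  = map₂ there (annotate-complete (suc n) w n<r (subst (r <_) (+-suc n (length w)) r<end))

  annotate-distinct : ∀ n (w : Word V) → Distinct (annotate n w)
  annotate-distinct n []      = tt
  annotate-distinct n (x ∷ w) = (λ h → <-irrefl refl (proj₁ (annotate-range w h))) , annotate-distinct (suc n) w

  before⇒< : ∀ {n} (w : Word V) {p q} → Before (annotate n w) p q → p < q
  before⇒< (x ∷ w) (≺-head h) = proj₁ (annotate-range w h)
  before⇒< (x ∷ w) (≺-tail b) = before⇒< w b

  <⇒before : ∀ {n} (w : Word V) {p q} → p < q → p ∈ₚ annotate n w → q ∈ₚ annotate n w →
             Before (annotate n w) p q
  <⇒before (x ∷ w) p<p (here refl) (here refl) = ⊥-elim (<-irrefl refl p<p)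
  <⇒before (x ∷ w) _   (here refl) (there hq)  = ≺-head hq
  <⇒before (x ∷ w) p<q (there hp)  (here refl) = ⊥-elim (<-asym p<q (proj₁ (annotate-range w hp)))
  <⇒before (x ∷ w) p<q (there hp)  (there hq)  = ≺-tail (<⇒before w p<q hp hq)

  annotate-head : ∀ {n} (w : Word V) {l} → (n , l) ∈ annotate n w → Σ (Word V) λ w′ → w ≡ l ∷ w′
  annotate-head (x ∷ w) (here refl) = w , refl
  annotate-head (x ∷ w) (there h)   = ⊥-elim (<-irrefl refl (proj₁ (annotate-range w (∈⇒∈ₚ h))))

  annotate-adjacent : ∀ {n} (w : Word V) {r l₁ l₂} → (r , l₁) ∈ annotate n w →
                      (suc r , l₂) ∈ annotate n w →
                      Σ (Word V) λ A → Σ (Word V) λ C → w ≡ A ++ l₁ ∷ l₂ ∷ C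
  annotate-adjacent (x ∷ w) (here refl) (here ())
  annotate-adjacent (x ∷ w) (here refl) (there m) with annotate-head w m
  ... | C , refl = [] , C , refl
  annotate-adjacent (x ∷ w) (there m) (here refl) =
    ⊥-elim (<-asym (n<1+n _) (proj₁ (annotate-range w (∈⇒∈ₚ m))))
  annotate-adjacent (x ∷ w) (there m₁) (there m₂) with annotate-adjacent w m₁ m₂
  ... | A , C , refl = x ∷ A , C , refl

  window-restrict : ∀ (pre c post : Word V) {r l} → (r , l) ∈ annotate 0 (pre ++ c ++ post) →
                    length pre ≤ r → r < length pre + length c → (r , l) ∈ annotate (length pre) c
  window-restrict pre c post {r} m s≤r r<e
    rewrite annotate-++ 0 pre (c ++ post) | annotate-++ (length pre) c post
    with ++⁻ (annotate 0 pre) m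
  ... | inj₁ m′ = ⊥-elim (<⇒≱ (proj₂ (annotate-range pre (∈⇒∈ₚ m′))) s≤r)
  ... | inj₂ m′ with ++⁻ (annotate (length pre) c) m′
  ...   | inj₁ m″ = m″
  ...   | inj₂ m″ = ⊥-elim (<⇒≱ r<e (proj₁ (annotate-range post (∈⇒∈ₚ m″))))

  window-extend : ∀ (pre c post : Word V) {r l} → (r , l) ∈ annotate (length pre) c →
                  (r , l) ∈ annotate 0 (pre ++ c ++ post)
  window-extend pre c post m
    rewrite annotate-++ 0 pre (c ++ post) | annotate-++ (length pre) c post =
    ++⁺ʳ (annotate 0 pre) (++⁺ˡ m)

InRange : ℕ → ℕ → ℕ → Set
InRange s n r = s ≤ r × r < s + n

module InsideContext {V : Set} (I : V → V → Set) (w pre c post : Word V)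
       (w≡ : w ≡ pre ++ c ++ post) (dep : Dependent I c) (irr : Irreducible I c)
       (π : Reduction I (annotate 0 w)) where
  open Positions {V}
  open Invariant I
  open Annotated {V}

  InC : ℕ → Set
  InC = InRange (length pre) (length c)

  restrict : ∀ {r l} → (r , l) ∈ annotate 0 w → InC r → (r , l) ∈ annotate (length pre) c
  restrict {r} {l} m (s≤r , r<e) =
    window-restrict pre c post (subst (λ v → (r , l) ∈ annotate 0 v) w≡ m) s≤r r<e

  letter-at : ∀ {r} → InC r → Σ (Op V) λ l → (r , l) ∈ annotate 0 w
  letter-at {r} (s≤r , r<e) =
    map₂ (λ m → subst (λ v → (r , _) ∈ annotate 0 v) (sym w≡) (window-extend pre c post m))
         (annotate-complete (length pre) c s≤r r<e)

  Inside : ℕ → ℕ → ℕ → Set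
  Inside p q r = p < r × r < q

  between : ∀ {p q r} → InC p → InC q → Inside p q r → InC r
  between (s≤p , _) (_ , q<e) (p<r , r<q) = ≤-trans s≤p (<⇒≤ p<r) , <-trans r<q q<e

  dependent-in-c : ∀ {p lp r l} → (p , lp) ∈ annotate 0 w → InC p →
                   (r , l) ∈ annotate 0 w → InC r → DepOp (proj₁ lp) (proj₁ l)
  dependent-in-c mp wp mr wr ne = dep lp∈c l∈c ne , dep l∈c lp∈c (ne ∘ sym)
    where
    lp∈c = annotate-letter c (restrict mp wp)
    l∈c  = annotate-letter c (restrict mr wr)

  nested-in-w : ∀ {p q} → (p , q) ∈ deleted I π → Nested (annotate 0 w) (deleted I π) p q
  nested-in-w = nested π (annotate-distinct 0 w)

  pair-ordered : ∀ {p q} → (p , q) ∈ deleted I π → p < q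
  pair-ordered pq = before⇒< w (Nested.p≺q (nested-in-w pq))

  -- two adjacent letters of c are not deleted together, as c is irreducible
  no-adjacent-pair : ∀ {p} → (p , suc p) ∈ deleted I π → InC p → InC (suc p) → ⊥
  no-adjacent-pair pq wp wq with nested-in-w pq
  ... | nest p∈ q∈ cancel _ _ with annotate-adjacent c (restrict p∈ wp) (restrict q∈ wq)
  ...   | A , C , c≡ = irr (subst (Reducible I) (sym c≡) (cancelling-reducible A C cancel))

  -- a pair p < q inside c that is not adjacent encloses another deleted pair:
  -- the letter at p + 1 and its partner
  closer-pair : ∀ {p q} → (p , q) ∈ deleted I π → InC p → InC q → suc p < q →
                Σ ℕ λ u → Σ ℕ λ v → (u , v) ∈ deleted I π × Inside p q u × Inside p q v
  closer-pair {p} {q} pq wp wq p+1<q with nested-in-w pq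
  ... | nest p∈ q∈ _ _ enclosed = from-partner partnered
    where
    wr = between wp wq (n<1+n p , p+1<q)
    l  = proj₁ (letter-at wr)
    r∈ = proj₂ (letter-at wr)
    partnered = enclosed r∈ (<⇒before w (n<1+n p) (∈⇒∈ₚ p∈) (∈⇒∈ₚ r∈))
                            (<⇒before w p+1<q (∈⇒∈ₚ r∈) (∈⇒∈ₚ q∈))
                            (dependent-in-c p∈ wp r∈ wr)
    inside : ∀ {r′} → Before (annotate 0 w) p r′ → Before (annotate 0 w) r′ q → Inside p q r′
    inside p≺r′ r′≺q = before⇒< w p≺r′ , before⇒< w r′≺q
    from-partner : PartnerBetween (annotate 0 w) (deleted I π) p q _ (suc p) →
                   Σ ℕ λ u → Σ ℕ λ v → (u , v) ∈ deleted I π × Inside p q u × Inside p q v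
    from-partner (partner r′ _ _ p≺r′ r′≺q _ (inj₁ rr′)) =
      suc p , r′ , rr′ , (n<1+n p , p+1<q) , inside p≺r′ r′≺q
    from-partner (partner r′ _ _ p≺r′ r′≺q _ (inj₂ r′r)) =
      r′ , suc p , r′r , inside p≺r′ r′≺q , (n<1+n p , p+1<q)

  closer : ∀ {p q u v} d → q ≤ p + suc d → Inside p q u → Inside p q v → v ≤ u + d
  closer {p} d q≤ (p<u , _) (_ , v<q) =
    ≤-trans (≤-pred (≤-trans v<q (≤-trans q≤ (≤-reflexive (+-suc p d)))))
            (+-monoˡ-≤ d (<⇒≤ p<u))

  no-pair-within : ∀ d {p q} → q ≤ p + d → (p , q) ∈ deleted I π → InC p → InC q → ⊥
  no-pair-within zero {p} {q} q≤p+0 pq _ _ =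
    <⇒≱ (pair-ordered pq) (subst (q ≤_) (+-identityʳ p) q≤p+0)
  no-pair-within (suc d) q≤ pq wp wq with m≤n⇒m<n∨m≡n (pair-ordered pq)
  ... | inj₂ refl = no-adjacent-pair pq wp wq
  ... | inj₁ p+1<q with closer-pair pq wp wq p+1<q
  ...   | u , v , uv , iu , iv =
    no-pair-within d (closer d q≤ iu iv) uv (between wp wq iu) (between wp wq iv)

  unpaired : ∀ {x y} → Paired (deleted I π) x y → InC x → InC y → ⊥
  unpaired {x} {y} (inj₁ xy) wx wy = no-pair-within y (m≤n+m y x) xy wx wy
  unpaired {x} {y} (inj₂ yx) wx wy = no-pair-within x (m≤n+m x y) yx wy wx

module Contexts {V : Set} (I : V → V → Set) where

  decomposition-concat : ∀ {w cs} → ContextDecomposition I w cs → w ≡ concat cs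
  decomposition-concat (cd-one {w} _ _)       = sym (++-identityʳ w)
  decomposition-concat (cd-more {p} _ _ _ cd) = cong (p ++_) (decomposition-concat cd)

  contexts-dependent : ∀ {w cs} → ContextDecomposition I w cs → All (Dependent I) cs
  contexts-dependent (cd-one _ dep)        = dep ∷ []
  contexts-dependent (cd-more _ dep _ cd)  = dep ∷ contexts-dependent cd

  concat-around : ∀ (cs : List (Word V)) (i : Fin (length cs)) →
                  concat cs ≡ concat (take (toℕ i) cs) ++ lookup cs i ++ concat (drop (suc (toℕ i)) cs)
  concat-around (c ∷ cs) Fin.zero    = refl
  concat-around (c ∷ cs) (Fin.suc i) = trans (cong (c ++_) (concat-around cs i)) (sym (++-assoc c _ _))

  length-concat : ∀ (xss : List (Word V)) → length (concat xss) ≡ sum (map length xss)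
  length-concat []         = refl
  length-concat (xs ∷ xss) = trans (length-++ xs) (cong (length xs +_) (length-concat xss))

  module _ {aw : AWord V} (π : Reduction I aw) (cs : List (Word V)) where

    related-letters : ∀ {u u′} → RInf I π cs u u′ →
                      Σ ℕ λ x → Σ ℕ λ y → LetterRel I π cs x y ×
                      Contains I π cs u (x , 1) × Contains I π cs u′ (y , 1)
    related-letters (base {x} {y} xRy) = x , y , xRy , (≤-refl , ≤-refl) , (≤-refl , ≤-refl)
    related-letters (join {a} {k₁} {k₂} {b} {l₂} {l₁} s₁Rs₂ _ _ _) with related-letters s₁Rs₂
    ... | x , y , xRy , (a+k₁≤x , x+1≤) , (b≤y , y+1≤) =
      x , y , xRy , (≤-trans (m≤m+n a k₁) a+k₁≤x , subst (x + 1 ≤_) (+-assoc a k₁ k₂) x+1≤) ,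
      (b≤y , ≤-trans y+1≤ (+-monoʳ-≤ b (m≤m+n l₂ l₁)))

    in-context : ∀ i {u x} → InContext I π cs i u → Contains I π cs u (x , 1) →
                 InRange (length (concat (take (toℕ i) cs))) (length (lookup cs i)) x
    in-context i {x = x} (start≤ , ≤end) (≤x , x+1≤) rewrite length-concat (take (toℕ i) cs) =
      ≤-trans start≤ ≤x , subst (_≤ sum (map length (take (toℕ i) cs)) + length (lookup cs i)) (+-comm x 1)
                                   (≤-trans x+1≤ ≤end)

no-relation-within-context : {V : Set} (I : V → V → Set) (w : Word V) (cs : List (Word V)) →
                             ContextDecomposition I w cs → All (Irreducible I) cs →
                             (π : Reduction I (annotate 0 w)) (i : Fin (length cs)) →
                             ∀ {u u′} → InContext I π cs i u → InContext I π cs i u′ →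
                             ¬ RInf I π cs u u′
no-relation-within-context I w cs decomposition irreducible π i u-in u′-in uRu′
  with x , y , xRy , u∋x , u′∋y ← Contexts.related-letters I π cs uRu′ =
  InsideContext.unpaired I w (concat (take (toℕ i) cs)) (lookup cs i) (concat (drop (suc (toℕ i)) cs))
    (trans (decomposition-concat decomposition) (concat-around cs i))
    (All.lookup (contexts-dependent decomposition) (∈-lookup i))
    (All.lookup irreducible (∈-lookup i)) π
    xRy (in-context π cs i u-in u∋x) (in-context π cs i u′-in u′∋y)
  where open Contexts I

lemma16 : {V : Set} (I : V → V → Set) → (∀ {a b} → I a b → I b a) →
          (w : Word V) → IsOne I w →
          (cs : List (Word V)) → ContextDecomposition I w cs →
          All (Irreducible I) cs →
          (π : Reduction I (annotate 0 w)) →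
          (i : Fin (length cs)) → (u u' : Infix) →
          Block I π cs i u → Block I π cs i u' →
          ¬ RInf I π cs u u'
lemma16 I _ w _ cs decomposition irreducible π i _ _ ((u-in , _) , _) ((u′-in , _) , _) =
  no-relation-within-context I w cs decomposition irreducible π i u-in u′-in
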